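{- Let $\mathcal E$ and $\widetilde{\mathcal E}$ be the periodic Zeckendorf collections for positive integers determined by lists $L$ and $\widetilde L$. For $n\ge2$ let $\hat\beta^n$ denote the immediate predecessor of $\beta^n$ in $\mathcal E$, i.e. the $<_a$-largest element of $\mathcal E$ that is $<_a\beta^n$. Then $\mathcal E\subseteq\widetilde{\mathcal E}$ if and only if $\hat\beta^n\in\widetilde{\mathcal E}$ for every $n\ge2$.
   Context: A coefficient function is a sequence $\mu=(\mu_1,\mu_2,\dots)$ of non-negative integers; it has finite support if only finitely many $\mu_k$ are nonzero. For $i\ge1$, $\beta^i$ has $\beta^i_i=1$ and $\beta^i_k=0$ for $k\ne i$. For $n\ge1$, $\mathrm{rev}_n(\mu)=(\mu_n,\mu_{n-1},\dots,\mu_1,0,0,\dots)$. For finite-support $\mu\ne\mu'$, $\mu<_a\mu'$ means $\mu_k<\mu'_k$ for the largest $k$ with $\mu_k\ne\mu'_k$. For a list $L=(e_1,\dots,e_N)$ of non-negative integers with $N\ge2$, $e_1\ne0$, let $\beta^*$ be the coefficient function with $\beta^*_k=e_j$ whenever $k\equiv j\pmod N$, $1\le j\le N$; for $n\ge2$ let $\theta^n=\mathrm{rev}_{n-1}(\beta^*)$ (the maximal $L$-block at index $n-1$, support interval $[1,n-1]$). A proper $L$-block at index $n-1$ ($n\ge2$) is a coefficient function $\zeta$ such that for some $k\in[1,n-1]$: $\zeta_j=\theta^n_j$ for $j>k$, $\zeta_k<\theta^n_k$, $\zeta_j=0$ for $j<k$; its support interval is $[k,n-1]$. The periodic Zeckendorf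 collection for positive integers determined by $L$ is the set of all finite sums (including $0$) of $L$-blocks with pairwise disjoint support intervals. -}

module Defs where

open import Data.Nat using (ℕ; zero; suc; _+_; _∸_; _≤_; _<_; _≟_; _%_)
open import Data.List using (List; []; _∷_; length)
open import Data.List.Relation.Unary.All using (All)
open import Data.List.Relation.Unary.AllPairs using (AllPairs)
open import Data.Product using (Σ; ∃; _×_; _,_)
open import Data.Sum using (_⊎_)
open import Data.Bool using (if_then_else_)
open import Relation.Nullary using (¬_)
open import Relation.Nullary.Decidable using (⌊_⌋)
open import Relation.Binary.PropositionalEquality using (_≡_)

-- A coefficient function μ = (μ₁, μ₂, …); the value at argument k is μ_k.
-- Argument 0 is unused (all objects considered below vanish there).
CoeffFun : Set
CoeffFun = ℕ → ℕ

_≈_ : CoeffFun → CoeffFun → Set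
μ ≈ ν = ∀ k → μ k ≡ ν k

β : ℕ → CoeffFun
β i k = if ⌊ k ≟ i ⌋ then 1 else 0

rev : ℕ → CoeffFun → CoeffFun
rev n μ zero = 0
rev n μ (suc k) = if ⌊ suc k Data.Nat.≤? n ⌋ then μ (suc n ∸ suc k) else 0

_<ₐ_ : CoeffFun → CoeffFun → Set
μ <ₐ μ' = ∃ λ k → μ k < μ' k × (∀ j → k < j → μ j ≡ μ' j)

ValidList : List ℕ → Set
ValidList [] = Data.Empty.⊥
  where import Data.Empty
ValidList (e ∷ rest) = 1 ≤ length rest × ¬ (e ≡ 0)

nth : List ℕ → ℕ → ℕ
nth [] _ = 0
nth (x ∷ xs) zero = x
nth (x ∷ xs) (suc j) = nth xs j

-- β*_k = e_j where k ≡ j (mod N), 1 ≤ j ≤ N  (i.e. 0-based entry (k-1) mod N)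
βstar : List ℕ → CoeffFun
βstar [] k = 0
βstar (e ∷ rest) k = nth (e ∷ rest) ((k ∸ 1) % suc (length rest))

θ : List ℕ → ℕ → CoeffFun
θ L n = rev (n ∸ 1) (βstar L)

-- IsBlock L ζ a b : ζ is an L-block at index b (b = n-1, n ≥ 2) with
-- support interval [a , b]
data IsBlock (L : List ℕ) (ζ : CoeffFun) : ℕ → ℕ → Set where
  maximal : ∀ {b} → 1 ≤ b → ζ ≈ θ L (suc b) → IsBlock L ζ 1 b
  proper  : ∀ {a b} → 1 ≤ a → a ≤ b →
            (∀ j → a < j → ζ j ≡ θ L (suc b) j) →
            ζ a < θ L (suc b) a →
            (∀ j → j < a → ζ j ≡ 0) →
            IsBlock L ζ a b

record BlockData : Set where
  constructor blk
  field
    fn : CoeffFun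
    lo : ℕ
    hi : ℕ
open BlockData public

DisjointIv : BlockData → BlockData → Set
DisjointIv x y = hi x < lo y ⊎ hi y < lo x

sumAt : List BlockData → ℕ → ℕ
sumAt [] k = 0
sumAt (x ∷ xs) k = fn x k + sumAt xs k

InZeck : List ℕ → CoeffFun → Set
InZeck L μ = ∃ λ (bs : List BlockData) →
  All (λ x → IsBlock L (fn x) (lo x) (hi x)) bs ×
  AllPairs DisjointIv bs ×
  μ ≈ (sumAt bs)

_⊆ᶻ_ : List ℕ → List ℕ → Set
L ⊆ᶻ L̃ = ∀ μ → InZeck L μ → InZeck L̃ μ

IsImmPred : List ℕ → ℕ → CoeffFun → Set
IsImmPred L n μ =
  InZeck L μ × μ <ₐ β n ×
  (∀ ν → InZeck L ν → ν <ₐ β n → ν ≈ μ ⊎ ν <ₐ μ)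

{-# OPTIONS --safe #-}
module Submission where

-- Any element of 𝓔(L) below β^n has its blocks inside [1, n-1], so its top block is θ^n itself
-- or lies <ₐ-below it: θ^n is the immediate predecessor of β^n.  Conversely, list the blocks of
-- μ ∈ 𝓔(L) from the top down.  The top block ζ, with support [a, b], agrees with θ^{b+1} above a
-- and is smaller at a, so an 𝓔(L̃)-representation of μ is grafted together from one of θ^{b+1},
-- lowered at a, and one of the remaining blocks of μ, obtained by induction.

open import Defs
open import Data.Nat using (ℕ; zero; suc; _+_; _≤_; _<_; _≟_; _<?_; _≤?_; z≤n; s≤s; z<s)
open import Data.Nat.Properties
open import Algebra.Properties.CommutativeSemigroup +-commutativeSemigroup using (x∙yz≈y∙xz)
open import Data.List using (List; []; _∷_; _++_; foldr)
open import Data.List.Relation.Unary.All using (All; []; _∷_)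
import Data.List.Relation.Unary.All as All
import Data.List.Relation.Unary.All.Properties as All
open import Data.List.Relation.Unary.AllPairs using (AllPairs; []; _∷_)
import Data.List.Relation.Unary.AllPairs as AllPairs
import Data.List.Relation.Unary.AllPairs.Properties as AllPairs
open import Data.Product using (_×_; _,_; Σ-syntax)
open import Data.Sum using (_⊎_; inj₁; inj₂)
import Data.Sum as Sum
open import Relation.Nullary using (yes; no; contradiction)
open import Relation.Binary using (Rel; Tri; tri<; tri≈; tri>)
open import Relation.Binary.PropositionalEquality

private
  variable
    L L̃ : List ℕ
    ζ μ ν ρ : CoeffFun
    a b c : ℕ
    x y : BlockData
    xs rest : List BlockData

VanishesFrom : ℕ → CoeffFun → Set
VanishesFrom c μ = ∀ j → c ≤ j → μ j ≡ 0

_<[_]_ : CoeffFun → ℕ → CoeffFun → Set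
μ <[ k ] ν = μ k < ν k × (∀ j → k < j → μ j ≡ ν j)

θ-vanishes : ∀ L b → VanishesFrom (suc b) (θ L (suc b))
θ-vanishes L b (suc j) b<j with suc j ≤? b
... | yes j<b = contradiction (<-≤-trans b<j j<b) (<-irrefl refl)
... | no _    = refl

θ-top-pos : ValidList L → 1 ≤ b → 0 < θ L (suc b) b
θ-top-pos {e ∷ _} {suc k} (_ , e≢0) _ with suc k ≤? suc k
... | no k≰k = contradiction ≤-refl k≰k
... | yes _ rewrite m+n∸n≡m 1 k = n≢0⇒n>0 e≢0

IsBlockOf : List ℕ → BlockData → Set
IsBlockOf L y = IsBlock L (fn y) (lo y) (hi y)

lo-pos : IsBlock L ζ a b → 1 ≤ a
lo-pos (maximal _ _)        = s≤s z≤n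
lo-pos (proper 1≤a _ _ _ _) = 1≤a

lo≤hi : IsBlock L ζ a b → a ≤ b
lo≤hi (maximal 1≤b _)      = 1≤b
lo≤hi (proper _ a≤b _ _ _) = a≤b

hi-pos : IsBlock L ζ a b → 1 ≤ b
hi-pos bl = ≤-trans (lo-pos bl) (lo≤hi bl)

vanishes-below-lo : IsBlock L ζ a b → ∀ j → j < a → ζ j ≡ 0
vanishes-below-lo (maximal _ ζ≈θ) zero    _          = ζ≈θ zero
vanishes-below-lo (maximal _ _)   (suc j) (s≤s ())
vanishes-below-lo (proper _ _ _ _ ζ≡0) j j<a = ζ≡0 j j<a

agrees-above-lo : IsBlock L ζ a b → ∀ j → a < j → ζ j ≡ θ L (suc b) j
agrees-above-lo (maximal _ ζ≈θ) j _          = ζ≈θ j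
agrees-above-lo (proper _ _ ζ≡θ _ _) j a<j = ζ≡θ j a<j

≤θ-from-lo : IsBlock L ζ a b → ∀ j → a ≤ j → ζ j ≤ θ L (suc b) j
≤θ-from-lo (maximal _ ζ≈θ) j _ = ≤-reflexive (ζ≈θ j)
≤θ-from-lo (proper _ _ ζ≡θ ζa<θa _) j a≤j with m≤n⇒m<n∨m≡n a≤j
... | inj₁ a<j  = ≤-reflexive (ζ≡θ j a<j)
... | inj₂ refl = <⇒≤ ζa<θa

vanishes-above-hi : IsBlock L ζ a b → VanishesFrom (suc b) ζ
vanishes-above-hi {L = L} {b = b} bl j b<j =
  trans (agrees-above-lo bl j (≤-<-trans (lo≤hi bl) b<j)) (θ-vanishes L b j b<j)

-- Since θ^{b+1}_b = e₁ ≠ 0, only a proper block with support {b} can vanish at b.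
block-zero : ValidList L → IsBlock L ζ a b → ζ b ≡ 0 → ∀ j → ζ j ≡ 0
block-zero VL (maximal 1≤b ζ≈θ) ζb≡0 _ =
  contradiction (trans (sym (ζ≈θ _)) ζb≡0) (n>0⇒n≢0 (θ-top-pos VL 1≤b))
block-zero {a = a} VL bl@(proper 1≤a a≤b _ _ _) ζb≡0 j with m≤n⇒m<n∨m≡n a≤b
... | inj₁ a<b =
  contradiction (trans (sym (agrees-above-lo bl _ a<b)) ζb≡0)
                (n>0⇒n≢0 (θ-top-pos VL (≤-trans 1≤a (<⇒≤ a<b))))
... | inj₂ refl with <-cmp j a
...   | tri< j<a _ _ = vanishes-below-lo bl j j<a
...   | tri≈ _ refl _ = ζb≡0
...   | tri> _ _ a<j = vanishes-above-hi bl j a<j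

sumAt-++ : ∀ xs ys j → sumAt (xs ++ ys) j ≡ sumAt xs j + sumAt ys j
sumAt-++ []       ys j = refl
sumAt-++ (x ∷ xs) ys j = trans (cong (fn x j +_) (sumAt-++ xs ys j)) (sym (+-assoc (fn x j) _ _))

sumAt-zero : ∀ {j} xs → All (λ y → fn y j ≡ 0) xs → sumAt xs j ≡ 0
sumAt-zero []       []          = refl
sumAt-zero (x ∷ xs) (x≡0 ∷ xs≡0) = cong₂ _+_ x≡0 (sumAt-zero xs xs≡0)

sumAt-vanishes-above : All (IsBlockOf L) xs → All (λ y → hi y < c) xs → VanishesFrom c (sumAt xs)
sumAt-vanishes-above vs hs j c≤j =
  sumAt-zero _ (All.zipWith (λ (v , h) → vanishes-above-hi v j (<-≤-trans h c≤j)) (vs , hs))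

sumAt-vanishes-below : All (IsBlockOf L) xs → All (λ y → c ≤ lo y) xs → ∀ j → j < c → sumAt xs j ≡ 0
sumAt-vanishes-below vs ls j j<c =
  sumAt-zero _ (All.zipWith (λ (v , l) → vanishes-below-lo v j (<-≤-trans j<c l)) (vs , ls))

no-block-below-1 : All (IsBlockOf L) xs → All (λ y → hi y < 1) xs → xs ≡ []
no-block-below-1 []      []      = refl
no-block-below-1 (v ∷ _) (h ∷ _) = contradiction (hi-pos v) (<⇒≱ h)

Descending : List BlockData → Set
Descending = AllPairs (λ x y → hi y < lo x)

descending-bounded : IsBlockOf L x → All (λ z → hi z < lo x) rest → hi x < c →
                     All (λ z → hi z < c) (x ∷ rest)
descending-bounded v under hx<c = hx<c ∷ All.map (λ z<x → <-trans z<x (≤-<-trans (lo≤hi v) hx<c)) under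

allPairs-++⁻ : ∀ {ℓ} {A : Set} {R : Rel A ℓ} xs {ys} → AllPairs R (xs ++ ys) →
               AllPairs R xs × AllPairs R ys × All (λ x → All (R x) ys) xs
allPairs-++⁻ []       Rys          = [] , Rys , []
allPairs-++⁻ (x ∷ xs) (Rx ∷ Rxsys) =
  let (Rxs , Rys , Rxsys') = allPairs-++⁻ xs Rxsys
  in  All.++⁻ˡ xs Rx ∷ Rxs , Rys , All.++⁻ʳ xs Rx ∷ Rxsys'

record DescRep (L : List ℕ) (μ : CoeffFun) : Set where
  constructor descRep
  field
    blocks     : List BlockData
    valid      : All (IsBlockOf L) blocks
    descending : Descending blocks
    sums       : μ ≈ sumAt blocks
open DescRep

DescRep-resp : μ ≈ ν → DescRep L ν → DescRep L μ
DescRep-resp μ≈ν (descRep bs vs ds ν≈) = descRep bs vs ds (λ j → trans (μ≈ν j) (ν≈ j))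

fromDescRep : DescRep L μ → InZeck L μ
fromDescRep (descRep bs vs ds μ≈) = bs , vs , AllPairs.map inj₂ ds , μ≈

insert : BlockData → List BlockData → List BlockData
insert y []       = y ∷ []
insert y (x ∷ xs) with hi x <? lo y
... | yes _ = y ∷ x ∷ xs
... | no  _ = x ∷ insert y xs

insert⁺ : ∀ {P : BlockData → Set} xs → P y → All P xs → All P (insert y xs)
insert⁺ []                 py []         = py ∷ []
insert⁺ {y = y} (x ∷ xs) py (px ∷ pxs) with hi x <? lo y
... | yes _ = py ∷ px ∷ pxs
... | no  _ = px ∷ insert⁺ xs py pxs

sumAt-insert : ∀ y xs j → sumAt (insert y xs) j ≡ fn y j + sumAt xs j
sumAt-insert y []       j = refl
sumAt-insert y (x ∷ xs) j with hi x <? lo y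
... | yes _ = refl
... | no  _ = trans (cong (fn x j +_) (sumAt-insert y xs j)) (x∙yz≈y∙xz (fn x j) (fn y j) (sumAt xs j))

insert-descending : ∀ xs → All (IsBlockOf L) xs → All (DisjointIv y) xs → Descending xs →
                    Descending (insert y xs)
insert-descending [] [] [] [] = [] ∷ []
insert-descending {y = y} (x ∷ xs) (v ∷ vs) (y#x ∷ y#xs) (under ∷ dxs) with hi x <? lo y
... | yes x<y = descending-bounded v under x<y ∷ under ∷ dxs
... | no  x≮y = insert⁺ xs (y<x y#x) under ∷ insert-descending xs vs y#xs dxs
  where
  y<x : DisjointIv y x → hi y < lo x
  y<x (inj₁ y<x) = y<x
  y<x (inj₂ x<y) = contradiction x<y x≮y

sort : List BlockData → List BlockData
sort = foldr insert []

sort⁺ : ∀ {P : BlockData → Set} xs → All P xs → All P (sort xs)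
sort⁺ []       []         = []
sort⁺ (x ∷ xs) (px ∷ pxs) = insert⁺ (sort xs) px (sort⁺ xs pxs)

sumAt-sort : ∀ xs j → sumAt (sort xs) j ≡ sumAt xs j
sumAt-sort []       j = refl
sumAt-sort (x ∷ xs) j = trans (sumAt-insert x (sort xs) j) (cong (fn x j +_) (sumAt-sort xs j))

sort-descending : ∀ xs → All (IsBlockOf L) xs → AllPairs DisjointIv xs → Descending (sort xs)
sort-descending []       []       []          = []
sort-descending (x ∷ xs) (_ ∷ vs) (x#xs ∷ ds) =
  insert-descending (sort xs) (sort⁺ xs vs) (sort⁺ xs x#xs) (sort-descending xs vs ds)

toDescRep : InZeck L μ → DescRep L μ
toDescRep (bs , vs , ds , μ≈) =
  descRep (sort bs) (sort⁺ bs vs) (sort-descending bs vs ds) (λ j → trans (μ≈ j) (sym (sumAt-sort bs j)))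

-- Drop zero blocks from the top until the top block is nonzero at its upper end.
boundedDescRep : ValidList L → VanishesFrom c μ → DescRep L μ →
                 Σ[ R ∈ DescRep L μ ] All (λ y → hi y < c) (blocks R)
boundedDescRep {L = L} {c = c} {μ = μ} VL van (descRep bs vs ds μ≈) = drop-zero-tops bs vs ds μ≈
  where
  drop-zero-tops : ∀ bs → All (IsBlockOf L) bs → Descending bs → μ ≈ sumAt bs →
                   Σ[ R ∈ DescRep L μ ] All (λ y → hi y < c) (blocks R)
  drop-zero-tops [] [] [] μ≈ = descRep [] [] [] μ≈ , []
  drop-zero-tops (x ∷ xs) (v ∷ vs) (under ∷ dxs) μ≈ with 0 <? fn x (hi x)
  ... | yes pos = descRep (x ∷ xs) (v ∷ vs) (under ∷ dxs) μ≈ , descending-bounded v under hx<c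
    where
    hx<c : hi x < c
    hx<c = ≰⇒> λ c≤hx →
      n>0⇒n≢0 (<-≤-trans pos (m≤m+n _ _)) (trans (sym (μ≈ (hi x))) (van (hi x) c≤hx))
  ... | no ¬pos = drop-zero-tops xs vs dxs μ≈xs
    where
    μ≈xs : μ ≈ sumAt xs
    μ≈xs j = trans (μ≈ j) (cong (_+ sumAt xs j) (block-zero VL v (n≤0⇒n≡0 (≮⇒≥ ¬pos)) j))

β-self : ∀ n → β n n ≡ 1
β-self n with n ≟ n
... | yes _   = refl
... | no n≢n = contradiction refl n≢n

β-other : ∀ {n j} → j ≢ n → β n j ≡ 0
β-other {n} {j} j≢n with j ≟ n
... | yes j≡n = contradiction j≡n j≢n
... | no _    = refl

<ₐβ⇒vanishes : ∀ {n} → ν <ₐ β n → VanishesFrom n ν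
<ₐβ⇒vanishes {n = n} (k , νk<βk , agree) j n≤j with k ≟ n
... | no _     = contradiction νk<βk n≮0
... | yes refl with m≤n⇒m<n∨m≡n n≤j
...   | inj₁ k<j  = trans (agree j k<j) (β-other (>⇒≢ k<j))
...   | inj₂ refl = n<1⇒n≡0 νk<βk

vanishes⇒<ₐβ : ∀ {n} → VanishesFrom n ν → ν <ₐ β n
vanishes⇒<ₐβ {n = n} van =
  n , subst₂ _<_ (sym (van n ≤-refl)) (sym (β-self n)) z<s
    , λ j n<j → trans (van j (<⇒≤ n<j)) (sym (β-other (>⇒≢ n<j)))

vanishes⇒<ₐθ : ValidList L → 1 ≤ b → VanishesFrom b ν → ν <ₐ θ L (suc b)
vanishes⇒<ₐθ {L = L} {b = b} VL 1≤b van =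
  b , subst (_< θ L (suc b) b) (sym (van b ≤-refl)) (θ-top-pos VL 1≤b)
    , λ j b<j → trans (van j (<⇒≤ b<j)) (sym (θ-vanishes L b j b<j))

block-on-top : IsBlock L ζ a b → All (IsBlockOf L) rest → All (λ z → hi z < a) rest →
               (∀ j → μ j ≡ ζ j + sumAt rest j) → μ ≈ θ L (suc b) ⊎ μ <[ a ] θ L (suc b)
block-on-top (maximal _ ζ≈θ) vs under μ≡ with no-block-below-1 vs under
... | refl = inj₁ λ j → trans (μ≡ j) (trans (+-identityʳ _) (ζ≈θ j))
block-on-top {ζ = ζ} {a = a} {μ = μ} (proper _ _ ζ≡θ ζa<θa _) vs under μ≡ =
  inj₂ (subst (_< _) (sym (μ≡ζ a ≤-refl)) ζa<θa , λ j a<j → trans (μ≡ζ j (<⇒≤ a<j)) (ζ≡θ j a<j))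
  where
  μ≡ζ : ∀ j → a ≤ j → μ j ≡ ζ j
  μ≡ζ j a≤j = trans (μ≡ j) (trans (cong (ζ j +_) (sumAt-vanishes-above vs under j a≤j)) (+-identityʳ _))

cut : ℕ → ℕ → CoeffFun → CoeffFun
cut a m ζ j with <-cmp a j
... | tri< _ _ _ = ζ j
... | tri≈ _ _ _ = m
... | tri> _ _ _ = 0

cut-above : ∀ {m j} → a < j → cut a m ζ j ≡ ζ j
cut-above {a = a} {j = j} a<j with <-cmp a j
... | tri< _ _ _    = refl
... | tri≈ a≮j _ _ = contradiction a<j a≮j
... | tri> a≮j _ _ = contradiction a<j a≮j

cut-at : ∀ {m} → cut a m ζ a ≡ m
cut-at {a = a} with <-cmp a a
... | tri< a<a _ _ = contradiction a<a (<-irrefl refl)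
... | tri≈ _ _ _   = refl
... | tri> _ _ a<a = contradiction a<a (<-irrefl refl)

cut-below : ∀ {m j} → j < a → cut a m ζ j ≡ 0
cut-below {a = a} {j = j} j<a with <-cmp a j
... | tri< _ _ j≮a = contradiction j<a j≮a
... | tri≈ _ _ j≮a = contradiction j<a j≮a
... | tri> _ _ _    = refl

cut-isBlock : ∀ {m} → IsBlock L ζ c b → c ≤ a → a ≤ b → m < ζ a → IsBlock L (cut a m ζ) a b
cut-isBlock {L = L} {ζ = ζ} {b = b} {a = a} bl c≤a a≤b m<ζa =
  proper (≤-trans (lo-pos bl) c≤a) a≤b
    (λ j a<j → trans (cut-above a<j) (agrees-above-lo bl j (≤-<-trans c≤a a<j)))
    (subst (_< θ L (suc b) a) (sym (cut-at {a = a} {ζ = ζ})) (<-≤-trans m<ζa (≤θ-from-lo bl a c≤a)))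
    (λ j j<a → cut-below j<a)

record Cover (a : ℕ) (cs : List BlockData) : Set where
  constructor cover-at
  field
    above    : List BlockData
    block    : BlockData
    below    : List BlockData
    split    : cs ≡ above ++ block ∷ below
    above-lo : All (λ x → a < lo x) above
    lo≤a     : lo block ≤ a
    a≤hi     : a ≤ hi block

cover : ∀ cs → All (IsBlockOf L) cs → Descending cs → 0 < sumAt cs a → Cover a cs
cover [] [] [] ()
cover {a = a} (x ∷ xs) (v ∷ vs) (under ∷ dxs) pos with a <? lo x
... | yes a<lo =
  let cover-at above y below split above-lo lo≤a a≤hi =
        cover xs vs dxs (subst (λ s → 0 < s + sumAt xs a) (vanishes-below-lo v a a<lo) pos)
  in  cover-at (x ∷ above) y below (cong (x ∷_) split) (a<lo ∷ above-lo) lo≤a a≤hi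
... | no a≮lo with a ≤? hi x
...   | yes a≤hi = cover-at [] x xs refl [] (≮⇒≥ a≮lo) a≤hi
...   | no  a≰hi = contradiction (subst (0 <_) sum≡0 pos) n≮0
  where
  sum≡0 : fn x a + sumAt xs a ≡ 0
  sum≡0 = cong₂ _+_ (vanishes-above-hi v a (≰⇒> a≰hi)) (sumAt-vanishes-above vs under a (≮⇒≥ a≮lo))

-- The block of ν covering a is lowered to μ a there and truncated below a,
-- the blocks of ν below a are replaced by those of ρ.
graft : DescRep L ν → μ <[ a ] ν → (R : DescRep L ρ) → All (λ z → hi z < a) (blocks R) →
        (∀ j → j < a → μ j ≡ ρ j) → DescRep L μ
graft {L = L} {ν = ν} {μ = μ} {a = a} {ρ = ρ}
      (descRep cs cvs cdesc ν≈) (μa<νa , μ≡ν) (descRep ds dvs ddesc ρ≈) ds<a μ≡ρ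
  with cover cs cvs cdesc (≤-<-trans z≤n (subst (μ a <_) (ν≈ a) μa<νa))
... | cover-at above y below refl above-lo lo≤a a≤hi
  with allPairs-++⁻ above cdesc | All.++⁻ above cvs
... | above-desc , (below-under-y ∷ _) , above-over | above-valid , (y-valid ∷ below-valid) =
  descRep (above ++ y′ ∷ ds)
          (All.++⁺ above-valid (cut-isBlock y-valid lo≤a a≤hi μa<ya ∷ dvs))
          (AllPairs.++⁺ above-desc (ds<a ∷ ddesc)
                        (All.zipWith (λ {x} → over-y′∷ds {x}) (above-over , above-lo)))
          (λ j → trans (μ≡split j) (sym (sumAt-++ above (y′ ∷ ds) j)))
  where
  open ≡-Reasoning

  y′ : BlockData
  y′ = blk (cut a (μ a) (fn y)) a (hi y)

  over-y′∷ds : ∀ {x : BlockData} → All (λ z → hi z < lo x) (y ∷ below) × a < lo x →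
               All (λ z → hi z < lo x) (y′ ∷ ds)
  over-y′∷ds ((y<x ∷ _) , a<x) = y<x ∷ All.map (λ z<a → <-trans z<a a<x) ds<a

  above≡0 : ∀ j → j ≤ a → sumAt above j ≡ 0
  above≡0 j j≤a = sumAt-vanishes-below above-valid above-lo j (s≤s j≤a)

  below≡0 : VanishesFrom a (sumAt below)
  below≡0 = sumAt-vanishes-above below-valid (All.map (λ z<y → <-≤-trans z<y lo≤a) below-under-y)

  ds≡0 : VanishesFrom a (sumAt ds)
  ds≡0 = sumAt-vanishes-above dvs ds<a

  ν≡split : ∀ j → ν j ≡ sumAt above j + (fn y j + sumAt below j)
  ν≡split j = trans (ν≈ j) (sumAt-++ above (y ∷ below) j)

  μa<ya : μ a < fn y a
  μa<ya = subst (μ a <_) νa≡ya μa<νa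
    where
    νa≡ya : ν a ≡ fn y a
    νa≡ya = begin
      ν a                                      ≡⟨ ν≡split a ⟩
      sumAt above a + (fn y a + sumAt below a) ≡⟨ cong₂ (λ s t → s + (fn y a + t))
                                                    (above≡0 a ≤-refl) (below≡0 a ≤-refl) ⟩
      fn y a + 0                               ≡⟨ +-identityʳ _ ⟩
      fn y a                                   ∎

  Spliced : ℕ → Set
  Spliced j = μ j ≡ sumAt above j + (cut a (μ a) (fn y) j + sumAt ds j)

  μ≡split : ∀ j → Spliced j
  μ≡split j = by-position (<-cmp a j)
    where
    by-position : Tri (a < j) (a ≡ j) (j < a) → Spliced j
    by-position (tri< a<j _ _) = begin
      μ j                                                   ≡⟨ μ≡ν j a<j ⟩
      ν j                                                   ≡⟨ ν≡split j ⟩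
      sumAt above j + (fn y j + sumAt below j)              ≡⟨ cong₂ (λ s t → sumAt above j + (s + t))
                                                                 (sym (cut-above a<j))
                                                                 (trans (below≡0 j (<⇒≤ a<j)) (sym (ds≡0 j (<⇒≤ a<j)))) ⟩
      sumAt above j + (cut a (μ a) (fn y) j + sumAt ds j)   ∎
    by-position (tri≈ _ a≡j _) = subst Spliced a≡j (begin
      μ a                                                   ≡⟨ +-identityʳ _ ⟨
      μ a + 0                                               ≡⟨ cong₂ _+_ (above≡0 a ≤-refl)
                                                                 (cong₂ _+_ (cut-at {a = a} {ζ = fn y}) (ds≡0 a ≤-refl)) ⟨
      sumAt above a + (cut a (μ a) (fn y) a + sumAt ds a)   ∎)
    by-position (tri> _ _ j<a) = begin
      μ j                                                   ≡⟨ μ≡ρ j j<a ⟩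
      ρ j                                                   ≡⟨ ρ≈ j ⟩
      sumAt ds j                                            ≡⟨ cong₂ (λ s t → s + (t + sumAt ds j))
                                                                 (above≡0 j (<⇒≤ j<a)) (cut-below {ζ = fn y} j<a) ⟨
      sumAt above j + (cut a (μ a) (fn y) j + sumAt ds j)   ∎

bounded⇒≤ₐθ : ValidList L → 1 ≤ b → (R : DescRep L ν) → All (λ y → hi y < suc b) (blocks R) →
              ν ≈ θ L (suc b) ⊎ ν <ₐ θ L (suc b)
bounded⇒≤ₐθ VL 1≤b (descRep [] [] [] ν≈) [] = inj₂ (vanishes⇒<ₐθ VL 1≤b λ j _ → ν≈ j)
bounded⇒≤ₐθ VL 1≤b (descRep (x ∷ xs) (v ∷ vs) (under ∷ _) ν≈) (hx<sb ∷ _)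
  with m≤n⇒m<n∨m≡n (≤-pred hx<sb)
... | inj₁ hx<b = inj₂ (vanishes⇒<ₐθ VL 1≤b λ j b≤j →
                    trans (ν≈ j) (sumAt-vanishes-above (v ∷ vs) (descending-bounded v under hx<b) j b≤j))
... | inj₂ refl = Sum.map₂ (lo x ,_) (block-on-top v vs under ν≈)

θ∈𝓔 : 1 ≤ b → InZeck L (θ L (suc b))
θ∈𝓔 {b = b} {L = L} 1≤b =
  fromDescRep (descRep (blk (θ L (suc b)) 1 b ∷ []) (maximal 1≤b (λ _ → refl) ∷ []) ([] ∷ [])
                       (λ _ → sym (+-identityʳ _)))

θ-isImmPred : ValidList L → 1 ≤ b → IsImmPred L (suc b) (θ L (suc b))
θ-isImmPred {L = L} {b = b} VL 1≤b = θ∈𝓔 1≤b , vanishes⇒<ₐβ (θ-vanishes L b) , θ-above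
  where
  θ-above : ∀ ν → InZeck L ν → ν <ₐ β (suc b) → ν ≈ θ L (suc b) ⊎ ν <ₐ θ L (suc b)
  θ-above ν ν∈ ν<β =
    let (R , R<sb) = boundedDescRep VL (<ₐβ⇒vanishes ν<β) (toDescRep ν∈)
    in  bounded⇒≤ₐθ VL 1≤b R R<sb

transfer-DescRep : ValidList L̃ → (∀ b → 1 ≤ b → InZeck L̃ (θ L (suc b))) →
                   ∀ bs → All (IsBlockOf L) bs → Descending bs → DescRep L̃ (sumAt bs)
transfer-DescRep VL̃ θ∈ [] [] [] = descRep [] [] [] (λ _ → refl)
transfer-DescRep VL̃ θ∈ (x ∷ xs) (v ∷ vs) (under ∷ dxs) with block-on-top v vs under (λ _ → refl)
... | inj₁ sum≈θ = DescRep-resp sum≈θ (toDescRep (θ∈ (hi x) (hi-pos v)))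
... | inj₂ sum<θ =
  let (R , R<lo) = boundedDescRep VL̃ (sumAt-vanishes-above vs under) (transfer-DescRep VL̃ θ∈ xs vs dxs)
  in  graft (toDescRep (θ∈ (hi x) (hi-pos v))) sum<θ R R<lo
            (λ j j<lo → cong (_+ sumAt xs j) (vanishes-below-lo v j j<lo))

θ∈⇒⊆ᶻ : ValidList L̃ → (∀ b → 1 ≤ b → InZeck L̃ (θ L (suc b))) → L ⊆ᶻ L̃
θ∈⇒⊆ᶻ VL̃ θ∈ μ μ∈ =
  let descRep bs vs ds μ≈ = toDescRep μ∈
  in  fromDescRep (DescRep-resp μ≈ (transfer-DescRep VL̃ θ∈ bs vs ds))

proposition3p1 : (L L̃ : List ℕ) → ValidList L → ValidList L̃ →
    ((L ⊆ᶻ L̃ → ∀ n → 2 ≤ n → ∀ μ → IsImmPred L n μ → InZeck L̃ μ) ×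
    ((∀ n → 2 ≤ n → ∀ μ → IsImmPred L n μ → InZeck L̃ μ) → L ⊆ᶻ L̃))
proposition3p1 L L̃ VL VL̃ =
  (λ L⊆L̃ _ _ μ (μ∈ , _) → L⊆L̃ μ μ∈) ,
  (λ preds → θ∈⇒⊆ᶻ VL̃ (λ b 1≤b → preds (suc b) (s≤s 1≤b) (θ L (suc b)) (θ-isImmPred VL 1≤b)))
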